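{- Let $k\geq 2$ and $n\geq 1$ be integers and let $\Delta$ be the maximum degree of the Windmill graph $Wd(k,n)$. Then for every integer $r$: $\chi_r(Wd(k,n)) = k$ if $2\leq r\leq k-1$, and $\chi_r(Wd(k,n)) = \min\{r,\Delta\}+1$ if $r\geq k$.
   Context: The Windmill graph $Wd(k,n)$ consists of $n$ copies of the complete graph $K_k$ in which one vertex from each copy is identified into a single common center vertex. For a graph $G$, $N_G(v)$ is the neighborhood of $v$, $d(v)=|N_G(v)|$, and $c(S)=\{c(u):u\in S\}$. For integers $k'>0$, $r>0$, a conditional $(k',r)$-coloring of $G$ is a surjective map $c\colon V(G)\to\{1,\ldots,k'\}$ such that $c(u)\neq c(v)$ for every edge $uv$, and $|c(N_G(v))|\geq \min\{d(v),r\}$ for every vertex $v$. $\chi_r(G)$ denotes the smallest $k'$ such that $G$ has a conditional $(k',r)$-coloring. -}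

module Defs where

open import Data.Bool using (Bool; true; false; _∧_; not; T)
open import Data.Nat using (ℕ; _≤_; _⊔_; _⊓_)
open import Data.Fin using (Fin)
import Data.Fin.Properties as FinP
open import Data.Maybe using (Maybe; just; nothing)
open import Data.Product using (_×_; _,_; ∃)
open import Data.List using (List; _∷_; []; map; filterᵇ; deduplicate; length; allFin; cartesianProduct; foldr)
open import Relation.Nullary using (¬_; ⌊_⌋)
open import Relation.Binary.PropositionalEquality using (_≡_)

-- A finite simple graph given by an explicit enumeration of its vertices
-- (each vertex listed exactly once) and a symmetric irreflexive Boolean adjacency.
record FinGraph : Set₁ where
  field
    V     : Set
    verts : List V
    adj   : V → V → Bool

open FinGraph public

nbhd : (G : FinGraph) → V G → List (V G)
nbhd G v = filterᵇ (adj G v) (verts G)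

degree : (G : FinGraph) → V G → ℕ
degree G v = length (nbhd G v)

maxDegree : (G : FinGraph) → ℕ
maxDegree G = foldr _⊔_ 0 (map (degree G) (verts G))

numColours : {G : FinGraph} {m : ℕ} → (V G → Fin m) → List (V G) → ℕ
numColours {m = m} c S = length (deduplicate FinP._≟_ (map c S))

record IsConditionalColouring (G : FinGraph) (m r : ℕ) (c : V G → Fin m) : Set where
  field
    surjective : ∀ (j : Fin m) → ∃ λ v → c v ≡ j
    proper     : ∀ u v → T (adj G u v) → ¬ (c u ≡ c v)
    condition  : ∀ v → degree G v ⊓ r ≤ numColours {G} c (nbhd G v)

HasConditionalColouring : FinGraph → ℕ → ℕ → Set
HasConditionalColouring G m r = ∃ λ (c : V G → Fin m) → IsConditionalColouring G m r c

ChiR≡ : FinGraph → ℕ → ℕ → Set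
ChiR≡ G r m = HasConditionalColouring G m r × (∀ m' → HasConditionalColouring G m' r → m ≤ m')

-- Windmill graph Wd(k,n): centre = nothing; just (i , a) = the a-th non-centre
-- vertex (a < k-1) of the i-th copy of K_k.
WdV : ℕ → ℕ → Set
WdV k n = Maybe (Fin n × Fin (k Data.Nat.∸ 1))

wdAdj : (k n : ℕ) → WdV k n → WdV k n → Bool
wdAdj k n nothing nothing = false
wdAdj k n nothing (just _) = true
wdAdj k n (just _) nothing = true
wdAdj k n (just (i , a)) (just (j , b)) = ⌊ i FinP.≟ j ⌋ ∧ not ⌊ a FinP.≟ b ⌋

Wd : ℕ → ℕ → FinGraph
Wd k n = record
  { V = WdV k n
  ; verts = nothing ∷ map just (cartesianProduct (allFin n) (allFin (k Data.Nat.∸ 1)))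
  ; adj = wdAdj k n
  }

module Submission where

-- Lower bounds: the centre together with one blade is a copy of K_k, so a proper colouring
-- needs k colours; and the centre, of degree Δ = n(k-1), must see min(r, Δ) colours other
-- than its own, so at least 1 + min(r, Δ) colours are needed.
-- Upper bound: the centre gets a colour of its own and the leaves get M colours (k-1 ≤ M ≤ Δ);
-- numbering the leaves 0, …, Δ-1 blade by blade, leaf number x gets colour x if x < M and
-- otherwise its position inside its blade. The leaves of a blade get distinct colours, and all M colours occur, so the centre
-- sees min(r, Δ) of them once M = min(r, Δ), or M = k-1 when r < k. A leaf's neighbourhood is
-- a clique, hence fully rainbow in any proper colouring.

open import Defs
open import Data.Bool using (T)
open import Data.Bool.Properties using (T?)
open import Data.Fin as Fin using (Fin; toℕ; fromℕ<; combine; inject≤)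
open import Data.Fin.Properties as Fin
  using (toℕ<n; toℕ-fromℕ<; toℕ-inject≤; toℕ-↑ˡ; toℕ-↑ʳ; toℕ-injective;
         combine-injectiveʳ; combine-surjective; injective⇒≤; nonZeroIndex)
open import Data.List
  using (List; []; _∷_; _++_; map; filter; length; allFin; cartesianProduct; foldr; deduplicate)
open import Data.List.Properties
  using (length-map; length-++; filter-notAll; filter-all; length-tabulate)
open import Data.List.Membership.Propositional using (_∈_)
open import Data.List.Membership.Propositional.Properties
  using (∈-map⁺; ∈-map⁻; ∈-filter⁺; ∈-filter⁻; ∈-allFin; ∈-cartesianProduct⁺;
         ∈-deduplicate⁺; ∈-deduplicate⁻)
open import Data.List.Relation.Binary.Subset.Propositional using (_⊆_)
open import Data.List.Relation.Unary.Any as Any using (here; there)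
open import Data.List.Relation.Unary.All as All using (All; []; _∷_)
import Data.List.Relation.Unary.All.Properties as All
open import Data.List.Relation.Unary.AllPairs as AllPairs using (AllPairs; []; _∷_)
import Data.List.Relation.Unary.AllPairs.Properties as AllPairs
open import Data.List.Relation.Unary.Unique.Propositional using (Unique)
import Data.List.Relation.Unary.Unique.Propositional.Properties as Unique
import Data.List.Relation.Unary.Unique.DecPropositional.Properties as Unique
open import Data.Maybe using (just; nothing)
open import Data.Nat using (ℕ; suc; _+_; _*_; _∸_; _⊓_; _⊔_; _≤_; _<_; z≤n; s≤s; s≤s⁻¹; _<?_)
open import Data.Nat.Properties
open import Data.Product using (_×_; _,_; ∃; ∃₂)
open import Data.Sum using (_⊎_; inj₁; inj₂)
open import Function using (_∘_; _⟨_⟩_)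
open import Relation.Binary.Definitions using (DecidableEquality)
open import Relation.Binary.PropositionalEquality
open import Relation.Nullary using (yes; no; ¬?; contradiction)

pattern centre = nothing
pattern leaf i a = just (i , a)

module _ {A : Set} where

  Unique-⊆⇒length≤ : DecidableEquality A → ∀ {xs ys : List A} →
                     Unique xs → xs ⊆ ys → length xs ≤ length ys
  Unique-⊆⇒length≤ _≟_ {[]} _ _ = z≤n
  Unique-⊆⇒length≤ _≟_ {x ∷ xs} {ys} (x∉xs ∷ xs!) xs⊆ys =
    ≤-<-trans (Unique-⊆⇒length≤ _≟_ xs! xs⊆ys∖x)
              (filter-notAll (¬? ∘ (x ≟_)) ys (Any.map (λ x≡ x≢ → x≢ x≡) (xs⊆ys (here refl))))
    where
    xs⊆ys∖x : xs ⊆ filter (¬? ∘ (x ≟_)) ys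
    xs⊆ys∖x y∈xs = ∈-filter⁺ (¬? ∘ (x ≟_)) (xs⊆ys (there y∈xs)) (All.lookup x∉xs y∈xs)

  Unique⇒AllPairs : ∀ {R : A → A → Set} {xs : List A} → Unique xs →
                    (∀ {u w} → u ∈ xs → w ∈ xs → u ≢ w → R u w) → AllPairs R xs
  Unique⇒AllPairs [] _ = []
  Unique⇒AllPairs (x∉xs ∷ xs!) R-on =
    All.tabulate (λ w∈xs → R-on (here refl) (there w∈xs) (All.lookup x∉xs w∈xs))
    ∷ Unique⇒AllPairs xs! (λ u∈ w∈ → R-on (there u∈) (there w∈))

foldr-⊔-lub : ∀ {b} (xs : List ℕ) → All (_≤ b) xs → foldr _⊔_ 0 xs ≤ b
foldr-⊔-lub [] [] = z≤n
foldr-⊔-lub (x ∷ xs) (x≤b ∷ xs≤b) = ⊔-lub x≤b (foldr-⊔-lub xs xs≤b)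

∈⇒≤foldr-⊔ : ∀ {x} {xs : List ℕ} → x ∈ xs → x ≤ foldr _⊔_ 0 xs
∈⇒≤foldr-⊔ {xs = y ∷ ys} (here refl) = m≤m⊔n y _
∈⇒≤foldr-⊔ {xs = y ∷ ys} (there x∈) = ≤-trans (∈⇒≤foldr-⊔ x∈) (m≤n⊔m y _)

length-cartesianProduct : ∀ {A B : Set} (xs : List A) (ys : List B) →
                          length (cartesianProduct xs ys) ≡ length xs * length ys
length-cartesianProduct [] ys = refl
length-cartesianProduct (x ∷ xs) ys = begin
    length (map (x ,_) ys ++ cartesianProduct xs ys)
  ≡⟨ length-++ (map (x ,_) ys) ⟩
    length (map (x ,_) ys) + length (cartesianProduct xs ys)
  ≡⟨ cong₂ _+_ (length-map (x ,_) ys) (length-cartesianProduct xs ys) ⟩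
    length ys + length xs * length ys ∎
  where open ≡-Reasoning

length-allFin : ∀ m → length (allFin m) ≡ m
length-allFin m = length-tabulate (λ i → i)

module _ (G : FinGraph) where

  IsProper : ∀ {m} → (V G → Fin m) → Set
  IsProper c = ∀ u v → T (adj G u v) → c u ≢ c v

  IsClique : List (V G) → Set
  IsClique = AllPairs (λ u w → T (adj G u w))

  ∈-nbhd⁺ : ∀ {v u} → u ∈ verts G → T (adj G v u) → u ∈ nbhd G v
  ∈-nbhd⁺ {v} = ∈-filter⁺ (T? ∘ adj G v)

  ∈-nbhd⁻ : ∀ {v u} → u ∈ nbhd G v → T (adj G v u)
  ∈-nbhd⁻ {v} u∈ with _ , vu ← ∈-filter⁻ (T? ∘ adj G v) {xs = verts G} u∈ = vu

  nbhd-unique : Unique (verts G) → ∀ v → Unique (nbhd G v)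
  nbhd-unique verts! v = Unique.filter⁺ (T? ∘ adj G v) verts!

  missing-colour⇒numColours< : ∀ {m} (c : V G → Fin m) S y →
                               (∀ {v} → v ∈ S → c v ≢ y) → numColours {G} c S < m
  missing-colour⇒numColours< {m} c S y y∉cS = begin-strict
      numColours {G} c S  <⟨ Unique-⊆⇒length≤ Fin._≟_ (y∉ ∷ Unique.deduplicate-! Fin._≟_ (map c S))
                                                      (λ {x} _ → ∈-allFin x) ⟩
      length (allFin m)   ≡⟨ length-allFin m ⟩
      m                   ∎
    where
    open ≤-Reasoning
    y∉ : All (y ≢_) (deduplicate Fin._≟_ (map c S))
    y∉ = All.tabulate λ x∈ y≡x →
      let v , v∈S , x≡cv = ∈-map⁻ c (∈-deduplicate⁻ Fin._≟_ (map c S) x∈)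
      in y∉cS v∈S (sym (trans y≡x x≡cv))

  sucColours∈⇒≤numColours : ∀ {M} (c : V G → Fin (suc M)) S →
                            (∀ j → Fin.suc j ∈ map c S) → M ≤ numColours {G} c S
  sucColours∈⇒≤numColours {M} c S sucColours∈ = begin
      M                                ≡⟨ sym (length-allFin M) ⟩
      length (allFin M)                ≡⟨ sym (length-map Fin.suc (allFin M)) ⟩
      length (map Fin.suc (allFin M))  ≤⟨ Unique-⊆⇒length≤ Fin._≟_ sucs! sucs⊆ ⟩
      numColours {G} c S               ∎
    where
    open ≤-Reasoning
    sucs! : Unique (map Fin.suc (allFin M))
    sucs! = Unique.map⁺ Fin.suc-injective (Unique.allFin⁺ M)
    sucs⊆ : map Fin.suc (allFin M) ⊆ deduplicate Fin._≟_ (map c S)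
    sucs⊆ j∈ with j , _ , refl ← ∈-map⁻ Fin.suc j∈ = ∈-deduplicate⁺ Fin._≟_ (sucColours∈ j)

  Unique⇒length≤numColours : ∀ {m} (c : V G → Fin m) S →
                             Unique (map c S) → length S ≤ numColours {G} c S
  Unique⇒length≤numColours c S cS! = begin
      length S            ≡⟨ sym (length-map c S) ⟩
      length (map c S)    ≤⟨ Unique-⊆⇒length≤ Fin._≟_ cS! (∈-deduplicate⁺ Fin._≟_) ⟩
      numColours {G} c S  ∎
    where open ≤-Reasoning

  proper⇒numColours-nbhd< : ∀ {m} {c : V G → Fin m} → IsProper c →
                            ∀ v → numColours {G} c (nbhd G v) < m
  proper⇒numColours-nbhd< {c = c} proper v =
    missing-colour⇒numColours< c (nbhd G v) (c v) (λ u∈ cu≡cv → proper v _ (∈-nbhd⁻ u∈) (sym cu≡cv))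

  clique⇒degree≤numColours : ∀ {m} {c : V G → Fin m} → IsProper c →
                             ∀ v → IsClique (nbhd G v) → degree G v ≤ numColours {G} c (nbhd G v)
  clique⇒degree≤numColours {c = c} proper v N-clique =
    Unique⇒length≤numColours c (nbhd G v) (AllPairs.map⁺ (AllPairs.map (proper _ _) N-clique))

  conditional⇒degree⊓r< : ∀ {m r} → HasConditionalColouring G m r → ∀ v → degree G v ⊓ r < m
  conditional⇒degree⊓r< (c , isCol) v = ≤-<-trans (condition v) (proper⇒numColours-nbhd< proper v)
    where open IsConditionalColouring isCol

  clique⇒size≤colours : ∀ {k m} {c : V G → Fin m} (f : Fin k → V G) →
                        (∀ {x y} → x ≢ y → T (adj G (f x) (f y))) → IsProper c → k ≤ m
  clique⇒size≤colours {c = c} f f-clique proper = injective⇒≤ c∘f-injective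
    where
    c∘f-injective : ∀ {x y} → c (f x) ≡ c (f y) → x ≡ y
    c∘f-injective {x} {y} cfx≡cfy with x Fin.≟ y
    ... | yes x≡y = x≡y
    ... | no x≢y = contradiction cfx≡cfy (proper _ _ (f-clique x≢y))

  maxDegree≡degree : ∀ {v} → v ∈ verts G → (∀ u → degree G u ≤ degree G v) → maxDegree G ≡ degree G v
  maxDegree≡degree v∈ maximal = ≤-antisym
    (foldr-⊔-lub (map (degree G) (verts G)) (All.tabulate degree≤))
    (∈⇒≤foldr-⊔ (∈-map⁺ (degree G) v∈))
    where
    degree≤ : ∀ {d} → d ∈ map (degree G) (verts G) → d ≤ _
    degree≤ d∈ with u , _ , refl ← ∈-map⁻ (degree G) d∈ = maximal u

module Windmill (K n : ℕ) where

  private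
    G : FinGraph
    G = Wd (suc K) n

    leaves : List (Fin n × Fin K)
    leaves = cartesianProduct (allFin n) (allFin K)

  leaf-adj⁻ : ∀ {i j a b} → T (adj G (leaf i a) (leaf j b)) → i ≡ j × a ≢ b
  leaf-adj⁻ {i} {j} {a} {b} ab with i Fin.≟ j | a Fin.≟ b
  ... | yes i≡j | no a≢b = i≡j , a≢b

  leaf-adj⁺ : ∀ {i a b} → a ≢ b → T (adj G (leaf i a) (leaf i b))
  leaf-adj⁺ {i} {a} {b} a≢b with i Fin.≟ i | a Fin.≟ b
  ... | yes _ | no _ = _
  ... | yes _ | yes a≡b = a≢b a≡b
  ... | no i≢i | _ = i≢i refl

  ∈-verts : ∀ v → v ∈ verts G
  ∈-verts centre = here refl
  ∈-verts (leaf i a) = there (∈-map⁺ just (∈-cartesianProduct⁺ (∈-allFin i) (∈-allFin a)))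

  verts-unique : Unique (verts G)
  verts-unique = All.tabulate centre∉
               ∷ Unique.map⁺ just-injective
                   (Unique.cartesianProduct⁺ (Unique.allFin⁺ n) (Unique.allFin⁺ K))
    where
    just-injective : ∀ {x y : Fin n × Fin K} → just x ≡ just y → x ≡ y
    just-injective refl = refl
    centre∉ : ∀ {v} → v ∈ map just leaves → centre ≢ v
    centre∉ v∈ centre≡v with _ , _ , refl ← ∈-map⁻ just v∈ with () ← centre≡v

  degree-centre : degree G centre ≡ n * K
  degree-centre = begin
      length (filter (T? ∘ adj G centre) (map just leaves))
    ≡⟨ cong length (filter-all (T? ∘ adj G centre) (All.map⁺ (All.universal _ leaves))) ⟩
      length (map just leaves)
    ≡⟨ length-map just leaves ⟩
      length leaves
    ≡⟨ length-cartesianProduct (allFin n) (allFin K) ⟩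
      length (allFin n) * length (allFin K)
    ≡⟨ cong₂ _*_ (length-allFin n) (length-allFin K) ⟩
      n * K ∎
    where open ≡-Reasoning

  nbhd-leaf-isClique : ∀ i a → IsClique G (nbhd G (leaf i a))
  nbhd-leaf-isClique i a = Unique⇒AllPairs (nbhd-unique G verts-unique (leaf i a)) distinct⇒adj
    where
    distinct⇒adj : ∀ {u w} → u ∈ nbhd G (leaf i a) → w ∈ nbhd G (leaf i a) → u ≢ w → T (adj G u w)
    distinct⇒adj {centre} {centre} _ _ u≢w = u≢w refl
    distinct⇒adj {centre} {leaf _ _} _ _ _ = _
    distinct⇒adj {leaf _ _} {centre} _ _ _ = _
    distinct⇒adj {leaf j b} {leaf j′ b′} u∈ w∈ u≢w
      with refl , _ ← leaf-adj⁻ {i} {j} {a} {b} (∈-nbhd⁻ G u∈)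
         | refl , _ ← leaf-adj⁻ {i} {j′} {a} {b′} (∈-nbhd⁻ G w∈) =
      leaf-adj⁺ (u≢w ∘ cong (leaf i))

  blade : Fin n → Fin (suc K) → WdV (suc K) n
  blade i Fin.zero = centre
  blade i (Fin.suc a) = leaf i a

  blade-isClique : ∀ i {x y} → x ≢ y → T (adj G (blade i x) (blade i y))
  blade-isClique i {Fin.zero} {Fin.zero} x≢y = x≢y refl
  blade-isClique i {Fin.zero} {Fin.suc _} _ = _
  blade-isClique i {Fin.suc _} {Fin.zero} _ = _
  blade-isClique i {Fin.suc a} {Fin.suc b} x≢y = leaf-adj⁺ (x≢y ∘ cong Fin.suc)

  toℕ-combine≡toℕ⇒≡ : ∀ (i : Fin n) {a b : Fin K} → toℕ (combine i a) ≡ toℕ b → a ≡ b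
  toℕ-combine≡toℕ⇒≡ Fin.zero {a} eq = toℕ-injective (trans (sym (toℕ-↑ˡ a _)) eq)
  toℕ-combine≡toℕ⇒≡ (Fin.suc i) {a} {b} eq = contradiction (toℕ<n b) (≤⇒≯ (begin
      K                            ≤⟨ m≤m+n K _ ⟩
      K + toℕ (combine i a)        ≡⟨ sym (toℕ-↑ʳ K (combine i a)) ⟩
      toℕ (combine (Fin.suc i) a)  ≡⟨ eq ⟩
      toℕ b                        ∎))
    where open ≤-Reasoning

  module Colouring (M : ℕ) (K≤M : K ≤ M) where

    leafColour : Fin n → Fin K → Fin M
    leafColour i a with toℕ (combine i a) <? M
    ... | yes i·a<M = fromℕ< i·a<M
    ... | no _ = inject≤ a K≤M

    toℕ-leafColour-< : ∀ i a → toℕ (combine i a) < M → toℕ (leafColour i a) ≡ toℕ (combine i a)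
    toℕ-leafColour-< i a i·a<M with toℕ (combine i a) <? M
    ... | yes i·a<M = toℕ-fromℕ< i·a<M
    ... | no i·a≮M = contradiction i·a<M i·a≮M

    toℕ-leafColour : ∀ i a → toℕ (leafColour i a) ≡ toℕ (combine i a) ⊎ toℕ (leafColour i a) ≡ toℕ a
    toℕ-leafColour i a with toℕ (combine i a) <? M
    ... | yes i·a<M = inj₁ (toℕ-fromℕ< i·a<M)
    ... | no _ = inj₂ (toℕ-inject≤ a K≤M)

    leafColour-injective : ∀ i {a b} → leafColour i a ≡ leafColour i b → a ≡ b
    leafColour-injective i {a} {b} ca≡cb with toℕ-leafColour i a | toℕ-leafColour i b
    ... | inj₁ ca≡ia | inj₁ cb≡ib = combine-injectiveʳ i a i b
                                      (toℕ-injective (sym ca≡ia ⟨ trans ⟩ cong toℕ ca≡cb ⟨ trans ⟩ cb≡ib))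
    ... | inj₂ ca≡a  | inj₂ cb≡b  = toℕ-injective (sym ca≡a ⟨ trans ⟩ cong toℕ ca≡cb ⟨ trans ⟩ cb≡b)
    ... | inj₁ ca≡ia | inj₂ cb≡b  = toℕ-combine≡toℕ⇒≡ i (sym ca≡ia ⟨ trans ⟩ cong toℕ ca≡cb ⟨ trans ⟩ cb≡b)
    ... | inj₂ ca≡a  | inj₁ cb≡ib =
      sym (toℕ-combine≡toℕ⇒≡ i (sym cb≡ib ⟨ trans ⟩ cong toℕ (sym ca≡cb) ⟨ trans ⟩ ca≡a))

    leafColour-surjective : M ≤ n * K → ∀ j → ∃₂ λ i a → leafColour i a ≡ j
    leafColour-surjective M≤n*K j with i , a , i·a≡j ← combine-surjective (inject≤ j M≤n*K) =
      i , a , toℕ-injective (begin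
        toℕ (leafColour i a)  ≡⟨ toℕ-leafColour-< i a (subst (_< M) (sym toℕ-i·a) (toℕ<n j)) ⟩
        toℕ (combine i a)     ≡⟨ toℕ-i·a ⟩
        toℕ j                 ∎)
      where
      open ≡-Reasoning
      toℕ-i·a : toℕ (combine i a) ≡ toℕ j
      toℕ-i·a = trans (cong toℕ i·a≡j) (toℕ-inject≤ j M≤n*K)

    colour : WdV (suc K) n → Fin (suc M)
    colour centre = Fin.zero
    colour (leaf i a) = Fin.suc (leafColour i a)

    colour-isProper : IsProper G colour
    colour-isProper centre centre () _
    colour-isProper centre (leaf _ _) _ ()
    colour-isProper (leaf _ _) centre _ ()
    colour-isProper (leaf i a) (leaf j b) ab ca≡cb with refl , a≢b ← leaf-adj⁻ {i} {j} {a} {b} ab =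
      a≢b (leafColour-injective i (Fin.suc-injective ca≡cb))

    colour-isConditional : ∀ {r} → M ≤ n * K → n * K ⊓ r ≤ M →
                           IsConditionalColouring G (suc M) r colour
    colour-isConditional {r} M≤n*K n*K⊓r≤M = record
      { surjective = surjective
      ; proper = colour-isProper
      ; condition = condition
      }
      where
      surjective : ∀ j → ∃ λ v → colour v ≡ j
      surjective Fin.zero = centre , refl
      surjective (Fin.suc j) with i , a , refl ← leafColour-surjective M≤n*K j = leaf i a , refl

      leafColours∈ : ∀ j → Fin.suc j ∈ map colour (nbhd G centre)
      leafColours∈ j with i , a , refl ← leafColour-surjective M≤n*K j =
        ∈-map⁺ colour (∈-nbhd⁺ G {centre} (∈-verts (leaf i a)) _)

      condition : ∀ v → degree G v ⊓ r ≤ numColours {G} colour (nbhd G v)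
      condition centre = begin
        degree G centre ⊓ r                    ≡⟨ cong (_⊓ r) degree-centre ⟩
        n * K ⊓ r                              ≤⟨ n*K⊓r≤M ⟩
        M                                      ≤⟨ sucColours∈⇒≤numColours G colour _ leafColours∈ ⟩
        numColours {G} colour (nbhd G centre)  ∎
        where open ≤-Reasoning
      condition (leaf i a) =
        ≤-trans (m⊓n≤m _ r) (clique⇒degree≤numColours G colour-isProper (leaf i a) (nbhd-leaf-isClique i a))

  degree-leaf≤K : ∀ i a → degree G (leaf i a) ≤ K
  degree-leaf≤K i a = s≤s⁻¹ (begin-strict
      degree G (leaf i a)                         ≤⟨ clique⇒degree≤numColours G colour-isProper (leaf i a)
                                                       (nbhd-leaf-isClique i a) ⟩
      numColours {G} colour (nbhd G (leaf i a))   <⟨ proper⇒numColours-nbhd< G colour-isProper (leaf i a) ⟩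
      suc K                                       ∎)
    where
    open Colouring K ≤-refl
    open ≤-Reasoning

  maxDegree-Wd : maxDegree G ≡ n * K
  maxDegree-Wd = trans (maxDegree≡degree G (∈-verts centre) degree≤centre) degree-centre
    where
    degree≤centre : ∀ v → degree G v ≤ degree G centre
    degree≤centre centre = ≤-refl
    degree≤centre (leaf i a) = begin
      degree G (leaf i a)  ≤⟨ degree-leaf≤K i a ⟩
      K                    ≤⟨ m≤n*m K n {{nonZeroIndex i}} ⟩
      n * K                ≡⟨ sym degree-centre ⟩
      degree G centre      ∎
      where open ≤-Reasoning

  conditional⇒n*K⊓r< : ∀ {m r} → HasConditionalColouring G m r → n * K ⊓ r < m
  conditional⇒n*K⊓r< {m} {r} χ =
    subst (λ d → d ⊓ r < m) degree-centre (conditional⇒degree⊓r< G χ centre)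

  conditionalColouring : ∀ {M r} → K ≤ M → M ≤ n * K → n * K ⊓ r ≤ M →
                         HasConditionalColouring G (suc M) r
  conditionalColouring {M} K≤M M≤n*K n*K⊓r≤M = colour , colour-isConditional M≤n*K n*K⊓r≤M
    where open Colouring M K≤M

proposition1 : ∀ (k n r : ℕ) → 2 ≤ k → 1 ≤ n →
    ((2 ≤ r → r ≤ k ∸ 1 → ChiR≡ (Wd k n) r k) ×
     (k ≤ r → ChiR≡ (Wd k n) r (suc (r ⊓ maxDegree (Wd k n)))))
proposition1 (suc K) n@(suc _) r (s≤s _) _ = χ-small , χ-large
  where
  open Windmill K n

  K≤n*K : K ≤ n * K
  K≤n*K = m≤n*m K n

  χ-small : 2 ≤ r → r ≤ K → ChiR≡ (Wd (suc K) n) r (suc K)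
  χ-small _ r≤K =
      conditionalColouring ≤-refl K≤n*K (≤-trans (m⊓n≤n _ r) r≤K)
    , λ _ (_ , χ) → clique⇒size≤colours (Wd (suc K) n) (blade Fin.zero) (blade-isClique Fin.zero)
                      (IsConditionalColouring.proper χ)

  χ-large : suc K ≤ r → ChiR≡ (Wd (suc K) n) r (suc (r ⊓ maxDegree (Wd (suc K) n)))
  χ-large K<r rewrite maxDegree-Wd =
      conditionalColouring (⊓-glb (≤-trans (n≤1+n K) K<r) K≤n*K) (m⊓n≤n r _) (≤-reflexive (⊓-comm _ r))
    , λ m χ → subst (_< m) (⊓-comm _ r) (conditional⇒n*K⊓r< χ)
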